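{- Let $k\geq 1$, let $p$ be a prime not dividing $k$, let $d=\gcd(k,p-1)$, and let $\alpha$ be the function associated to the polynomial $x^k$. Then for all $n\geq 1$ (with $\alpha(1)=1$), \[\alpha(p^n)=\begin{cases}p\,\alpha(p^{n-1})-(d-1)(p-1)/d, & \text{if } n\equiv 1\pmod k,\\ p\,\alpha(p^{n-1})-p+1, & \text{if } n\not\equiv 1\pmod k.\end{cases}\] Moreover, if $n\equiv r\pmod k$ with $1\leq r\leq k$, then \[\alpha(p^n)=\frac{p^{n+k-1}-p^{r-1}}{d\cdot\frac{p^k-1}{p-1}}+1.\]
   Context: For a positive integer $n$, $\alpha(n)$ is the number of $a\in\{0,1,\ldots,n-1\}$ such that the congruence $x^k\equiv a\pmod n$ has an integer solution. -}

module Defs where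

open import Data.Nat using (ℕ; zero; suc; _+_; _^_; _≡ᵇ_)
open import Data.Nat.DivMod using (_%_)
open import Data.Bool using (Bool; true; false)
open import Data.List using (List; filterᵇ; length; upTo)
open import Data.Bool.ListAction using (any)

-- x^k ≡ a (mod n), computed with n-residues (n ≥ 1 at all uses).
-- isPowRes n k a = true iff some x ∈ {0,…,n-1} has x^k mod n = a.
-- Since x^k mod n depends only on x mod n, this is the same as existence of
-- an integer solution of x^k ≡ a (mod n).
isPowRes : ℕ → ℕ → ℕ → Bool
isPowRes zero    k a = false
isPowRes (suc m) k a = any (λ x → ((x ^ k) % suc m) ≡ᵇ a) (upTo (suc m))

α : ℕ → ℕ → ℕ
α k n = length (filterᵇ (isPowRes n k) (upTo n))

module Submission where

-- Let U be the number of non-zero k-th power residues modulo p.  Modulo p^n,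
-- a unit is a k-th power iff it is one modulo p (Hensel lifting, as p ∤ k),
-- which gives p^(n-1) U unit residues; a multiple of p is a k-th power only if
-- it is 0 (for n ≤ k) or p^k times a k-th power residue modulo p^(n-k).  Hence
-- α(p^(m+1)) = p^m U + 1 for m < k and α(p^(k+n+1)) = p^(k+n) U + α(p^(n+1)),
-- whence α(p^(r+1+qk)) = 1 + U p^r (1 + p^k + … + p^(qk)).  Modulo p, the
-- fibres of the k-th power map on units all have the size of its kernel; with
-- Fermat's little theorem and the bound on the number of roots of a
-- polynomial this gives U · gcd(k, p - 1) = p - 1.  The two recurrences and the
-- closed form of the theorem then follow by arithmetic.

open import Defs
open import Data.Nat
  using (ℕ; zero; suc; _+_; _*_; _∸_; _^_; _≤_; _<_; z≤n; s≤s; NonZero; >-nonZero; >-nonZero⁻¹; ≢-nonZero; nonTrivial⇒n>1)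
open import Data.Nat.Properties
open import Data.Nat.DivMod
open import Data.Nat.Divisibility
open import Data.Bool using (Bool; true; false; T; T?; if_then_else_)
open import Data.List using (List; []; _∷_; length; filterᵇ; applyUpTo; upTo; replicate)
open import Data.List.Properties using (length-replicate)
open import Data.List.Relation.Unary.Any.Properties using (any⁺; any⁻; applyUpTo⁺; applyUpTo⁻)
open import Function using (id)
open import Data.Product using (_×_; _,_; ∃; proj₁; proj₂)
open import Data.Sum using (_⊎_; inj₁; inj₂)
open import Data.Unit using (tt)
open import Relation.Binary.PropositionalEquality
open import Relation.Binary using (tri<; tri≈; tri>)
open import Relation.Nullary using (¬_; Dec; yes; no; does; ¬?; _×-dec_; contradiction; map′)
open import Relation.Unary using (Pred; Decidable)
open import Level using (0ℓ)
open import Data.Nat.Primality using (Prime; euclidsLemma; prime⇒nonZero; prime⇒nonTrivial; prime⇒irreducible)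
open import Data.Nat.Coprimality using (Coprime; coprime-Bézout)
open import Data.Nat.GCD using (gcd; gcd-GCD; gcd[m,n]∣m; gcd[m,n]∣n; gcd[m,n]≢0; module Bézout)
open import Data.Nat.Tactic.RingSolver using (solve-∀)

multiple-below : ∀ {L a} → L ∣ a → a < L → a ≡ 0
multiple-below {a = zero}  _   _   = refl
multiple-below {a = suc a} L∣a a<L = contradiction (∣⇒≤ L∣a) (<⇒≱ a<L)

^-pres-∣ : ∀ {d x} k → d ∣ x → d ^ k ∣ x ^ k
^-pres-∣ zero    d∣x = ∣-refl
^-pres-∣ (suc k) d∣x = *-pres-∣ d∣x (^-pres-∣ k d∣x)

^-monoʳ-∣ : ∀ b {m n} → m ≤ n → b ^ m ∣ b ^ n
^-monoʳ-∣ b {m} {n} m≤n = divides (b ^ (n ∸ m)) (begin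
  b ^ n               ≡⟨ cong (b ^_) (sym (m∸n+n≡m m≤n)) ⟩
  b ^ (n ∸ m + m)     ≡⟨ ^-distribˡ-+-* b (n ∸ m) m ⟩
  b ^ (n ∸ m) * b ^ m ∎)
  where open ≡-Reasoning

^-distribʳ-* : ∀ a b m → (a * b) ^ m ≡ a ^ m * b ^ m
^-distribʳ-* a b zero    = refl
^-distribʳ-* a b (suc m) = trans (cong (a * b *_) (^-distribʳ-* a b m)) (interchange a b (a ^ m) (b ^ m))
  where
  interchange : ∀ a b x y → a * b * (x * y) ≡ a * x * (b * y)
  interchange = solve-∀

factor-bound : ∀ {I K e d} → I ≤ e → K ≤ d → 0 < d → I * K ≡ e * d → I ≡ e
factor-bound {I} {d = d} I≤e K≤d 0<d IK≡ed with m≤n⇒m<n∨m≡n I≤e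
... | inj₂ I≡e = I≡e
... | inj₁ I<e = contradiction IK≡ed (<⇒≢ (≤-<-trans (*-monoʳ-≤ I K≤d) (*-monoˡ-< d {{>-nonZero 0<d}} I<e)))

geometric : ℕ → ℕ → ℕ
geometric P zero    = 1
geometric P (suc q) = geometric P q + P ^ suc q

geometric-horner : ∀ P q → geometric P (suc q) ≡ 1 + P * geometric P q
geometric-horner P zero    = refl
geometric-horner P (suc q) = begin
  geometric P (suc q) + P ^ suc (suc q)      ≡⟨ cong (_+ P ^ suc (suc q)) (geometric-horner P q) ⟩
  1 + P * geometric P q + P * P ^ suc q      ≡⟨ +-assoc 1 (P * geometric P q) (P * P ^ suc q) ⟩
  1 + (P * geometric P q + P * P ^ suc q)    ≡⟨ cong (1 +_) (sym (*-distribˡ-+ P _ _)) ⟩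
  1 + P * (geometric P q + P ^ suc q)        ∎
  where open ≡-Reasoning

geometric-sum : ∀ {P X} q → P ≡ suc X → geometric P q * X + 1 ≡ P ^ suc q
geometric-sum {P} {X} zero    P≡1+X =
  trans (cong (_+ 1) (*-identityˡ X)) (trans (+-comm X 1) (trans (sym P≡1+X) (sym (*-identityʳ P))))
geometric-sum {P} {X} (suc q) P≡1+X = begin
  (G + P ^ suc q) * X + 1       ≡⟨ regroup G (P ^ suc q) X ⟩
  (G * X + 1) + P ^ suc q * X   ≡⟨ cong (_+ P ^ suc q * X) (geometric-sum q P≡1+X) ⟩
  P ^ suc q + P ^ suc q * X     ≡⟨ trans (cong (P ^ suc q +_) (*-comm (P ^ suc q) X)) (cong (_* P ^ suc q) (sym P≡1+X)) ⟩
  P * P ^ suc q                 ∎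
  where
  open ≡-Reasoning
  G = geometric P q
  regroup : ∀ G Y X → (G + Y) * X + 1 ≡ (G * X + 1) + Y * X
  regroup = solve-∀

binomial-linear : ∀ k y h → ∃ λ E → (y + h) ^ suc k ≡ y ^ suc k + suc k * y ^ k * h + h * h * E
binomial-linear zero y h = 0 , ring y h
  where
  ring : ∀ y h → (y + h) * 1 ≡ y * 1 + 1 * 1 * h + h * h * 0
  ring = solve-∀
binomial-linear (suc k) y h with binomial-linear k y h
... | E , expand = y * E + suc k * y ^ k + h * E , trans (cong ((y + h) *_) expand) (ring y h (y ^ k) E k)
  where
  ring : ∀ y h Y E k → (y + h) * (y * Y + (1 + k) * Y * h + h * h * E) ≡
         y * (y * Y) + (2 + k) * (y * Y) * h + h * h * (y * E + (1 + k) * Y + h * E)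
  ring = solve-∀

%-+ : ∀ N .{{_ : NonZero N}} {a a′ b b′} → a % N ≡ a′ % N → b % N ≡ b′ % N → (a + b) % N ≡ (a′ + b′) % N
%-+ N {a} {a′} {b} {b′} e₁ e₂ =
  trans (%-distribˡ-+ a b N) (trans (cong₂ (λ x y → (x + y) % N) e₁ e₂) (sym (%-distribˡ-+ a′ b′ N)))

%-* : ∀ N .{{_ : NonZero N}} {a a′ b b′} → a % N ≡ a′ % N → b % N ≡ b′ % N → (a * b) % N ≡ (a′ * b′) % N
%-* N {a} {a′} {b} {b′} e₁ e₂ =
  trans (%-distribˡ-* a b N) (trans (cong₂ (λ x y → (x * y) % N) e₁ e₂) (sym (%-distribˡ-* a′ b′ N)))

%-*ˡ : ∀ N .{{_ : NonZero N}} a {b b′} → b % N ≡ b′ % N → (a * b) % N ≡ (a * b′) % N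
%-*ˡ N a = %-* N {a} {a} refl

%-pow : ∀ N .{{_ : NonZero N}} k {a b} → a % N ≡ b % N → (a ^ k) % N ≡ (b ^ k) % N
%-pow N zero    e = refl
%-pow N (suc k) e = %-* N e (%-pow N k e)

%⇒∣∸ : ∀ N .{{_ : NonZero N}} {a b} → a ≤ b → a % N ≡ b % N → N ∣ b ∸ a
%⇒∣∸ N {a} {b} a≤b e = divides (b / N ∸ a / N) (begin
  b ∸ a                                     ≡⟨ cong₂ _∸_ (m≡m%n+[m/n]*n b N) (m≡m%n+[m/n]*n a N) ⟩
  (b % N + b / N * N) ∸ (a % N + a / N * N) ≡⟨ cong (λ z → (b % N + b / N * N) ∸ (z + a / N * N)) e ⟩
  (b % N + b / N * N) ∸ (b % N + a / N * N) ≡⟨ [m+n]∸[m+o]≡n∸o (b % N) _ _ ⟩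
  b / N * N ∸ a / N * N                     ≡⟨ sym (*-distribʳ-∸ N (b / N) (a / N)) ⟩
  (b / N ∸ a / N) * N                       ∎)
  where open ≡-Reasoning

∣∸⇒% : ∀ N .{{_ : NonZero N}} {a b} → a ≤ b → N ∣ b ∸ a → a % N ≡ b % N
∣∸⇒% N {a} {b} a≤b (divides q e) = begin
  a % N               ≡⟨ sym ([m+kn]%n≡m%n a q N) ⟩
  (a + q * N) % N     ≡⟨ cong (λ z → (a + z) % N) (sym e) ⟩
  (a + (b ∸ a)) % N   ≡⟨ cong (_% N) (m+[n∸m]≡n a≤b) ⟩
  b % N               ∎
  where open ≡-Reasoning

%-divisor : ∀ d N .{{_ : NonZero d}} .{{_ : NonZero N}} {a b} → d ∣ N → a % N ≡ b % N → a % d ≡ b % d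
%-divisor d N {a} {b} d∣N e = trans (sym (m∣n⇒o%n%m≡o%m d N a d∣N)) (trans (cong (_% d) e) (m∣n⇒o%n%m≡o%m d N b d∣N))

%-scale : ∀ N L .{{_ : NonZero N}} .{{_ : NonZero (N * L)}} {u v} → u % N ≡ v % N → (u * L) % (N * L) ≡ (v * L) % (N * L)
%-scale N L {u} {v} e = trans (sym (m%n*o≡m*o%[n*o] u N L)) (trans (cong (_* L) e) (m%n*o≡m*o%[n*o] v N L))

%-*-common : ∀ K M a .{{_ : NonZero K}} .{{_ : NonZero M}} → _%_ (K * a) (K * M) {{m*n≢0 K M}} ≡ K * (a % M)
%-*-common K M a = begin
  (K * a) % (K * M)  ≡⟨ cong (_% (K * M)) (*-comm K a) ⟩
  (a * K) % (K * M)  ≡⟨ %-congʳ (*-comm K M) ⟩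
  (a * K) % (M * K)  ≡⟨ sym (m%n*o≡m*o%[n*o] a M K) ⟩
  (a % M) * K        ≡⟨ *-comm (a % M) K ⟩
  K * (a % M)        ∎
  where
  open ≡-Reasoning
  instance
    K*M≢0 : NonZero (K * M)
    K*M≢0 = m*n≢0 K M
    M*K≢0 : NonZero (M * K)
    M*K≢0 = m*n≢0 M K

%-injective : ∀ N .{{_ : NonZero N}} {u v} → u < N → v < N → u % N ≡ v % N → u ≡ v
%-injective N u<N v<N e = trans (sym (m<n⇒m%n≡m u<N)) (trans e (m<n⇒m%n≡m v<N))

sumBelow : (ℕ → ℕ) → ℕ → ℕ
sumBelow g zero    = 0
sumBelow g (suc n) = g 0 + sumBelow (λ i → g (suc i)) n

sumBelow-cong : ∀ n {g h : ℕ → ℕ} → (∀ i → i < n → g i ≡ h i) → sumBelow g n ≡ sumBelow h n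
sumBelow-cong zero    e = refl
sumBelow-cong (suc n) e = cong₂ _+_ (e 0 (s≤s z≤n)) (sumBelow-cong n (λ i i<n → e (suc i) (s≤s i<n)))

sumBelow-mono : ∀ n {g h : ℕ → ℕ} → (∀ i → i < n → g i ≤ h i) → sumBelow g n ≤ sumBelow h n
sumBelow-mono zero    e = z≤n
sumBelow-mono (suc n) e = +-mono-≤ (e 0 (s≤s z≤n)) (sumBelow-mono n (λ i i<n → e (suc i) (s≤s i<n)))

sumBelow-zero : ∀ n → sumBelow (λ _ → 0) n ≡ 0
sumBelow-zero zero    = refl
sumBelow-zero (suc n) = sumBelow-zero n

sumBelow-+ : ∀ n (g h : ℕ → ℕ) → sumBelow (λ i → g i + h i) n ≡ sumBelow g n + sumBelow h n
sumBelow-+ zero    g h = refl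
sumBelow-+ (suc n) g h = begin
  g 0 + h 0 + sumBelow (λ i → g (suc i) + h (suc i)) n
    ≡⟨ cong (g 0 + h 0 +_) (sumBelow-+ n (λ i → g (suc i)) (λ i → h (suc i))) ⟩
  g 0 + h 0 + (sumBelow (λ i → g (suc i)) n + sumBelow (λ i → h (suc i)) n)
    ≡⟨ +-interchange (g 0) (h 0) _ _ ⟩
  g 0 + sumBelow (λ i → g (suc i)) n + (h 0 + sumBelow (λ i → h (suc i)) n) ∎
  where
  open ≡-Reasoning
  +-interchange : ∀ a b c d → a + b + (c + d) ≡ a + c + (b + d)
  +-interchange = solve-∀

sumBelow-* : ∀ n c (g : ℕ → ℕ) → sumBelow (λ i → c * g i) n ≡ c * sumBelow g n
sumBelow-* zero    c g = sym (*-zeroʳ c)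
sumBelow-* (suc n) c g =
  trans (cong (c * g 0 +_) (sumBelow-* n c (λ i → g (suc i)))) (sym (*-distribˡ-+ c (g 0) _))

sumBelow-split : ∀ m n (g : ℕ → ℕ) → sumBelow g (m + n) ≡ sumBelow g m + sumBelow (λ i → g (m + i)) n
sumBelow-split zero    n g = refl
sumBelow-split (suc m) n g =
  trans (cong (g 0 +_) (sumBelow-split m n (λ i → g (suc i)))) (sym (+-assoc (g 0) _ _))

indicator : {A : Set} → Dec A → ℕ
indicator a? = if does a? then 1 else 0

count : {P : Pred ℕ 0ℓ} → Decidable P → ℕ → ℕ
count P? = sumBelow (λ i → indicator (P? i))

indicator-mono : {A B : Set} (a? : Dec A) (b? : Dec B) → (A → B) → indicator a? ≤ indicator b?
indicator-mono (yes a) (yes b) f = ≤-refl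
indicator-mono (yes a) (no ¬b) f = contradiction (f a) ¬b
indicator-mono (no ¬a) b?      f = z≤n

indicator-cong : {A B : Set} (a? : Dec A) (b? : Dec B) → (A → B) → (B → A) → indicator a? ≡ indicator b?
indicator-cong a? b? f g = ≤-antisym (indicator-mono a? b? f) (indicator-mono b? a? g)

module _ {P Q : Pred ℕ 0ℓ} (P? : Decidable P) (Q? : Decidable Q) where

  count-mono : ∀ n → (∀ i → i < n → P i → Q i) → count P? n ≤ count Q? n
  count-mono n f = sumBelow-mono n (λ i i<n → indicator-mono (P? i) (Q? i) (f i i<n))

  count-cong : ∀ n → (∀ i → i < n → P i → Q i) → (∀ i → i < n → Q i → P i) → count P? n ≡ count Q? n
  count-cong n f g = sumBelow-cong n (λ i i<n → indicator-cong (P? i) (Q? i) (f i i<n) (g i i<n))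

  count-split : ∀ n → count P? n ≡ count (λ i → P? i ×-dec ¬? (Q? i)) n + count (λ i → P? i ×-dec Q? i) n
  count-split n = trans (sumBelow-cong n (λ i _ → split (P? i) (Q? i))) (sumBelow-+ n _ _)
    where
    split : {A B : Set} (a? : Dec A) (b? : Dec B) →
            indicator a? ≡ indicator (a? ×-dec ¬? b?) + indicator (a? ×-dec b?)
    split (yes a) (yes b) = refl
    split (yes a) (no ¬b) = refl
    split (no ¬a) b?      = refl

count-none : {P : Pred ℕ 0ℓ} (P? : Decidable P) → ∀ n → (∀ i → i < n → ¬ P i) → count P? n ≡ 0
count-none P? zero    ¬P = refl
count-none P? (suc n) ¬P with P? 0
... | yes P0 = contradiction P0 (¬P 0 (s≤s z≤n))
... | no _   = count-none (λ i → P? (suc i)) n (λ i i<n → ¬P (suc i) (s≤s i<n))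

count-all : {P : Pred ℕ 0ℓ} (P? : Decidable P) → ∀ n → (∀ i → i < n → P i) → count P? n ≡ n
count-all P? zero    allP = refl
count-all P? (suc n) allP with P? 0
... | yes _  = cong suc (count-all (λ i → P? (suc i)) n (λ i i<n → allP (suc i) (s≤s i<n)))
... | no ¬P0 = contradiction (allP 0 (s≤s z≤n)) ¬P0

count-unique : {P : Pred ℕ 0ℓ} (P? : Decidable P) → ∀ n a → a < n →
               (∀ i → i < n → P i → i ≡ a) → P a → count P? n ≡ 1
count-unique P? (suc n) zero    _ only Pa with P? 0
... | no ¬P0 = contradiction Pa ¬P0
... | yes _  = cong suc (count-none (λ i → P? (suc i)) n (λ i i<n P → 0≢1+n (sym (only (suc i) (s≤s i<n) P))))
count-unique P? (suc n) (suc a) (s≤s a<n) only Pa with P? 0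
... | yes P0 = contradiction (only 0 (s≤s z≤n) P0) 0≢1+n
... | no _   = count-unique (λ i → P? (suc i)) n a a<n (λ i i<n P → suc-injective (only (suc i) (s≤s i<n) P)) Pa

count-fibres : {P : Pred ℕ 0ℓ} (P? : Decidable P) (h : ℕ → ℕ) → ∀ n M → (∀ x → x < n → P x → h x < M) →
               sumBelow (λ c → count (λ x → P? x ×-dec (h x ≟ c)) n) M ≡ count P? n
count-fibres P? h zero    M h<M = sumBelow-zero M
count-fibres P? h (suc n) M h<M = begin
  sumBelow (λ c → indicator (P? 0 ×-dec (h 0 ≟ c)) + count (λ x → P? (suc x) ×-dec (h (suc x) ≟ c)) n) M
    ≡⟨ sumBelow-+ M _ _ ⟩
  count (λ c → P? 0 ×-dec (h 0 ≟ c)) M + sumBelow (λ c → count (λ x → P? (suc x) ×-dec (h (suc x) ≟ c)) n) M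
    ≡⟨ cong₂ _+_ (column (P? 0) (h<M 0 (s≤s z≤n)))
                 (count-fibres (λ x → P? (suc x)) (λ x → h (suc x)) n M (λ x x<n → h<M (suc x) (s≤s x<n))) ⟩
  indicator (P? 0) + count (λ x → P? (suc x)) n ∎
  where
  open ≡-Reasoning
  column : {A : Set} (a? : Dec A) → (A → h 0 < M) → count (λ c → a? ×-dec (h 0 ≟ c)) M ≡ indicator a?
  column (yes a) lt = count-unique (λ c → yes a ×-dec (h 0 ≟ c)) M (h 0) (lt a) (λ _ _ Pc → sym (proj₂ Pc)) (a , refl)
  column (no ¬a) lt = count-none (λ c → no ¬a ×-dec (h 0 ≟ c)) M (λ _ _ Pc → ¬a (proj₁ Pc))

count-injection : {P Q : Pred ℕ 0ℓ} (P? : Decidable P) (Q? : Decidable Q) (f : ℕ → ℕ) → ∀ n m →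
  (∀ i → i < n → P i → f i < m × Q (f i)) →
  (∀ i j → i < n → j < n → P i → P j → f i ≡ f j → i ≡ j) →
  count P? n ≤ count Q? m
count-injection P? Q? f zero m into inj = z≤n
count-injection {P} P? Q? f (suc n) m into inj with P? 0
... | no _ = count-injection (λ i → P? (suc i)) Q? (λ i → f (suc i)) n m
               (λ i i<n → into (suc i) (s≤s i<n))
               (λ i j i<n j<n Pi Pj e → suc-injective (inj (suc i) (suc j) (s≤s i<n) (s≤s j<n) Pi Pj e))
... | yes P0 = begin
  suc (count (λ i → P? (suc i)) n)
    ≤⟨ s≤s (count-injection (λ i → P? (suc i)) Q′? (λ i → f (suc i)) n m
              (λ i i<n Pi → proj₁ (into (suc i) (s≤s i<n) Pi) , proj₂ (into (suc i) (s≤s i<n) Pi) , avoids i i<n Pi)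
              (λ i j i<n j<n Pi Pj e → suc-injective (inj (suc i) (suc j) (s≤s i<n) (s≤s j<n) Pi Pj e))) ⟩
  suc (count Q′? m)
    ≡⟨ trans (+-comm 1 _) (cong (count Q′? m +_) (sym hit)) ⟩
  count Q′? m + count (λ y → Q? y ×-dec (y ≟ f 0)) m
    ≡⟨ sym (count-split Q? (_≟ f 0) m) ⟩
  count Q? m ∎
  where
  open ≤-Reasoning
  Q′? = λ y → Q? y ×-dec ¬? (y ≟ f 0)
  avoids : ∀ i → i < n → P (suc i) → ¬ f (suc i) ≡ f 0
  avoids i i<n Pi e = 0≢1+n (sym (inj (suc i) 0 (s≤s i<n) (s≤s z≤n) Pi P0 e))
  hit : count (λ y → Q? y ×-dec (y ≟ f 0)) m ≡ 1
  hit = count-unique (λ y → Q? y ×-dec (y ≟ f 0)) m (f 0) (proj₁ (into 0 (s≤s z≤n) P0))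
          (λ _ _ Qy → proj₂ Qy) (proj₂ (into 0 (s≤s z≤n) P0) , refl)

least : {P : Pred ℕ 0ℓ} (P? : Decidable P) → ∀ n →
        (∀ i → i < n → ¬ P i) ⊎ ∃ λ j → j < n × P j × (∀ l → l < j → ¬ P l)
least P? zero = inj₁ (λ i ())
least P? (suc n) with P? 0
... | yes P0 = inj₂ (0 , s≤s z≤n , P0 , λ l ())
... | no ¬P0 with least (λ i → P? (suc i)) n
...   | inj₁ none = inj₁ λ { zero _ → ¬P0 ; (suc i) (s≤s i<n) → none i i<n }
...   | inj₂ (j , j<n , Pj , below) = inj₂ (suc j , s≤s j<n , Pj , λ { zero _ → ¬P0 ; (suc l) (s≤s l<j) → below l l<j })

count-nonzero : ∀ n → count (λ x → ¬? (x ≟ 0)) (suc n) ≡ n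
count-nonzero n = count-all (λ x → ¬? (suc x ≟ 0)) n (λ i _ ())

count-periodic : {P : Pred ℕ 0ℓ} (P? : Decidable P) → ∀ M N .{{_ : NonZero N}} →
                 count (λ a → P? (a % N)) (M * N) ≡ M * count P? N
count-periodic P? zero N = refl
count-periodic P? (suc M) N = begin
  count (λ a → P? (a % N)) (N + M * N)
    ≡⟨ sumBelow-split N (M * N) _ ⟩
  count (λ a → P? (a % N)) N + count (λ i → P? ((N + i) % N)) (M * N)
    ≡⟨ cong₂ _+_ (sumBelow-cong N (λ i i<N → cong (λ z → indicator (P? z)) (m<n⇒m%n≡m i<N)))
                 (sumBelow-cong (M * N) (λ i _ → cong (λ z → indicator (P? z)) (shift i))) ⟩
  count P? N + count (λ a → P? (a % N)) (M * N)
    ≡⟨ cong (count P? N +_) (count-periodic P? M N) ⟩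
  count P? N + M * count P? N ∎
  where
  open ≡-Reasoning
  shift : ∀ i → (N + i) % N ≡ i % N
  shift i = trans (cong (_% N) (+-comm N i)) ([m+n]%n≡m%n i N)

count-multiples : {P : Pred ℕ 0ℓ} (P? : Decidable P) → ∀ L M .{{_ : NonZero L}} →
                  count (λ a → (L ∣? a) ×-dec P? a) (L * M) ≡ count (λ b → P? (L * b)) M
count-multiples P? L zero = cong (count (λ a → (L ∣? a) ×-dec P? a)) (*-zeroʳ L)
count-multiples {P} P? L (suc M) = begin
  count Mult? (L * suc M)
    ≡⟨ cong (count Mult?) (*-suc L M) ⟩
  count Mult? (L + L * M)
    ≡⟨ sumBelow-split L (L * M) _ ⟩
  count Mult? L + count (λ i → Mult? (L + i)) (L * M)
    ≡⟨ cong₂ _+_ (firstBlock (P? 0))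
                 (count-cong (λ i → Mult? (L + i)) (λ i → (L ∣? i) ×-dec P? (L + i)) (L * M) (λ i _ → shiftˡ i) (λ i _ → shiftʳ i)) ⟩
  indicator (P? 0) + count (λ i → (L ∣? i) ×-dec P? (L + i)) (L * M)
    ≡⟨ cong₂ _+_ (cong (λ z → indicator (P? z)) (sym (*-zeroʳ L)))
                 (count-multiples (λ i → P? (L + i)) L M) ⟩
  indicator (P? (L * 0)) + count (λ b → P? (L + L * b)) M
    ≡⟨ cong (indicator (P? (L * 0)) +_) (sumBelow-cong M (λ b _ → cong (λ z → indicator (P? z)) (sym (*-suc L b)))) ⟩
  count (λ b → P? (L * b)) (suc M) ∎
  where
  open ≡-Reasoning
  Mult? = λ a → (L ∣? a) ×-dec P? a
  shiftˡ : ∀ i → L ∣ L + i × P (L + i) → L ∣ i × P (L + i)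
  shiftˡ i (L∣L+i , P) = ∣m+n∣m⇒∣n L∣L+i ∣-refl , P
  shiftʳ : ∀ i → L ∣ i × P (L + i) → L ∣ L + i × P (L + i)
  shiftʳ i (L∣i , P) = ∣m∣n⇒∣m+n ∣-refl L∣i , P
  firstBlock : (P0? : Dec (P 0)) → count Mult? L ≡ indicator P0?
  firstBlock (yes P0) = count-unique Mult? L 0 (>-nonZero⁻¹ L)
                          (λ a a<L M → multiple-below (proj₁ M) a<L) (L ∣0 , P0)
  firstBlock (no ¬P0) = count-none Mult? L (λ a a<L M → ¬P0 (subst P (multiple-below (proj₁ M) a<L) (proj₂ M)))

PowRes : (N k a : ℕ) .{{_ : NonZero N}} → Set
PowRes N k a = ∃ λ x → (x ^ k) % N ≡ a

isPowRes⇒PowRes : ∀ N k a .{{_ : NonZero N}} → T (isPowRes N k a) → PowRes N k a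
isPowRes⇒PowRes (suc m) k a t with applyUpTo⁻ id (any⁻ _ (upTo (suc m)) t)
... | x , _ , x^k≡a = x , ≡ᵇ⇒≡ _ a x^k≡a

PowRes⇒isPowRes : ∀ N k a .{{_ : NonZero N}} → PowRes N k a → T (isPowRes N k a)
PowRes⇒isPowRes (suc m) k a (x , x^k≡a) =
  any⁺ _ (applyUpTo⁺ id (≡⇒≡ᵇ _ a (trans (%-pow (suc m) k (m%n%n≡m%n x (suc m))) x^k≡a)) (m%n<n x (suc m)))

powRes? : ∀ N k .{{_ : NonZero N}} → Decidable (λ a → PowRes N k a)
powRes? N k a = map′ (isPowRes⇒PowRes N k a) (PowRes⇒isPowRes N k a) (T? (isPowRes N k a))

count-filter : ∀ (f : ℕ → Bool) (g : ℕ → ℕ) n → length (filterᵇ f (applyUpTo g n)) ≡ count (λ i → T? (f (g i))) n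
count-filter f g zero = refl
count-filter f g (suc n) with f (g 0)
... | true  = cong suc (count-filter f (λ i → g (suc i)) n)
... | false = count-filter f (λ i → g (suc i)) n

α-count : ∀ k N .{{_ : NonZero N}} → α k N ≡ count (powRes? N k) N
α-count k N = count-filter (isPowRes N k) id N

module ModPrime {p : ℕ} (pr : Prime p) where
  instance
    p≢0 : NonZero p
    p≢0 = prime⇒nonZero pr

  1<p : 1 < p
  1<p = nonTrivial⇒n>1 p {{prime⇒nonTrivial pr}}

  p≡1+[p∸1] : p ≡ suc (p ∸ 1)
  p≡1+[p∸1] = sym (suc-pred p)

  p∸1<p : p ∸ 1 < p
  p∸1<p = subst (p ∸ 1 <_) (sym p≡1+[p∸1]) (n<1+n (p ∸ 1))

  1%p : 1 % p ≡ 1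
  1%p = m<n⇒m%n≡m 1<p

  unit-* : ∀ {a b} → ¬ p ∣ a → ¬ p ∣ b → ¬ p ∣ a * b
  unit-* {a} {b} ¬p∣a ¬p∣b p∣ab with euclidsLemma a b pr p∣ab
  ... | inj₁ p∣a = ¬p∣a p∣a
  ... | inj₂ p∣b = ¬p∣b p∣b

  ¬p∣1 : ¬ p ∣ 1
  ¬p∣1 p∣1 = <⇒≢ 1<p (sym (∣1⇒≡1 p∣1))

  unit-^ : ∀ {a} k → ¬ p ∣ a → ¬ p ∣ a ^ k
  unit-^ zero    ¬p∣a = ¬p∣1
  unit-^ (suc k) ¬p∣a = unit-* ¬p∣a (unit-^ k ¬p∣a)

  ∣^⇒∣ : ∀ {x} k → p ∣ x ^ k → p ∣ x
  ∣^⇒∣ {x} k p∣x^k with p ∣? x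
  ... | yes p∣x = p∣x
  ... | no ¬p∣x = contradiction p∣x^k (unit-^ k ¬p∣x)

  nonzero⇒unit : ∀ {x} → x < p → ¬ x ≡ 0 → ¬ p ∣ x
  nonzero⇒unit x<p x≢0 p∣x = x≢0 (multiple-below p∣x x<p)

  unit⇒%≢0 : ∀ {x} → ¬ p ∣ x → ¬ x % p ≡ 0
  unit⇒%≢0 ¬p∣x x%p≡0 = ¬p∣x (m%n≡0⇒n∣m _ p x%p≡0)

  *-cancelˡ-%-≤ : ∀ {a b c} → ¬ p ∣ a → b ≤ c → (a * b) % p ≡ (a * c) % p → b % p ≡ c % p
  *-cancelˡ-%-≤ {a} {b} {c} ¬p∣a b≤c e
    with euclidsLemma a (c ∸ b) pr (subst (p ∣_) (sym (*-distribˡ-∸ a c b)) (%⇒∣∸ p (*-monoʳ-≤ a b≤c) e))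
  ... | inj₁ p∣a   = contradiction p∣a ¬p∣a
  ... | inj₂ p∣c∸b = ∣∸⇒% p b≤c p∣c∸b

  *-cancelˡ-% : ∀ {a b c} → ¬ p ∣ a → (a * b) % p ≡ (a * c) % p → b % p ≡ c % p
  *-cancelˡ-% {a} {b} {c} ¬p∣a e with ≤-total b c
  ... | inj₁ b≤c = *-cancelˡ-%-≤ ¬p∣a b≤c e
  ... | inj₂ c≤b = sym (*-cancelˡ-%-≤ ¬p∣a c≤b (sym e))

  coprime : ∀ {a} → ¬ p ∣ a → Coprime p a
  coprime ¬p∣a (i∣p , i∣a) with prime⇒irreducible pr i∣p
  ... | inj₁ i≡1 = i≡1
  ... | inj₂ refl = contradiction i∣a ¬p∣a

  inverse : ∀ {a} → ¬ p ∣ a → ∃ λ u → (u * a) % p ≡ 1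
  inverse {a} ¬p∣a with coprime-Bézout (coprime ¬p∣a)
  ... | Bézout.-+ x y 1+xp≡ya = y , (begin
    (y * a) % p      ≡⟨ cong (_% p) (sym 1+xp≡ya) ⟩
    (1 + x * p) % p  ≡⟨ [m+kn]%n≡m%n 1 x p ⟩
    1 % p            ≡⟨ 1%p ⟩
    1                ∎)
    where open ≡-Reasoning
  ... | Bézout.+- x y 1+ya≡xp = (p ∸ 1) * y , (begin
    ((p ∸ 1) * y * a) % p                ≡⟨ sym ([m+n]%n≡m%n _ p) ⟩
    ((p ∸ 1) * y * a + p) % p            ≡⟨ cong (_% p) (regroup (p ∸ 1) p y a (m∸n+n≡m (<⇒≤ 1<p))) ⟩
    (1 + (p ∸ 1) * (1 + y * a)) % p      ≡⟨ cong (λ z → (1 + (p ∸ 1) * z) % p) 1+ya≡xp ⟩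
    (1 + (p ∸ 1) * (x * p)) % p          ≡⟨ cong (λ z → (1 + z) % p) (sym (*-assoc (p ∸ 1) x p)) ⟩
    (1 + (p ∸ 1) * x * p) % p            ≡⟨ [m+kn]%n≡m%n 1 ((p ∸ 1) * x) p ⟩
    1 % p                                ≡⟨ 1%p ⟩
    1                                    ∎)
    where
    open ≡-Reasoning
    regroup : ∀ q p y a → q + 1 ≡ p → q * y * a + p ≡ 1 + q * (1 + y * a)
    regroup q .(q + 1) y a refl = ring q y a
      where
      ring : ∀ q y a → q * y * a + (q + 1) ≡ 1 + q * (1 + y * a)
      ring = solve-∀

  one-power : ∀ {y} i → y % p ≡ 1 → (y ^ i) % p ≡ 1
  one-power {y} i y≡1 = trans (%-pow p i (trans y≡1 (sym 1%p))) (trans (cong (_% p) (^-zeroˡ i)) 1%p)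

  power-multiple : ∀ {x} m a → (x ^ m) % p ≡ 1 → (x ^ (a * m)) % p ≡ 1
  power-multiple {x} m a x^m≡1 =
    trans (cong (λ e → (x ^ e) % p) (*-comm a m)) (trans (cong (_% p) (sym (^-*-assoc x m a))) (one-power a x^m≡1))

  one-factor : ∀ {y z} → z % p ≡ 1 → (y * z) % p ≡ 1 → y % p ≡ 1
  one-factor {y} {z} z≡1 yz≡1 = trans (cong (_% p) (sym (*-identityʳ y))) (trans (%-*ˡ p y (trans 1%p (sym z≡1))) yz≡1)

  power-gcd : ∀ {x} a b → (x ^ a) % p ≡ 1 → (x ^ b) % p ≡ 1 → (x ^ gcd a b) % p ≡ 1
  power-gcd {x} a b x^a≡1 x^b≡1 with Bézout.identity (gcd-GCD a b)
  ... | Bézout.+- s t g+tb≡sa = one-factor (power-multiple b t x^b≡1)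
          (trans (cong (_% p) (sym (^-distribˡ-+-* x (gcd a b) (t * b))))
                 (trans (cong (λ e → (x ^ e) % p) g+tb≡sa) (power-multiple a s x^a≡1)))
  ... | Bézout.-+ s t g+sa≡tb = one-factor (power-multiple a s x^a≡1)
          (trans (cong (_% p) (sym (^-distribˡ-+-* x (gcd a b) (s * a))))
                 (trans (cong (λ e → (x ^ e) % p) g+sa≡tb) (power-multiple b t x^b≡1)))

  power-collision : ∀ {x} i d → ¬ p ∣ x → (x ^ i) % p ≡ (x ^ (i + d)) % p → (x ^ d) % p ≡ 1
  power-collision {x} i d ¬p∣x e = trans (sym (*-cancelˡ-% (unit-^ i ¬p∣x) (begin
    (x ^ i * 1) % p    ≡⟨ cong (_% p) (*-identityʳ (x ^ i)) ⟩
    (x ^ i) % p        ≡⟨ e ⟩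
    (x ^ (i + d)) % p  ≡⟨ cong (_% p) (^-distribˡ-+-* x i d) ⟩
    (x ^ i * x ^ d) % p ∎))) 1%p
    where open ≡-Reasoning

  powers-apart : ∀ {x} n → ¬ p ∣ x → (∀ l → l < n → ¬ (x ^ suc l) % p ≡ 1) →
                 ∀ {i j} → i < j → j ≤ n → ¬ (x ^ i) % p ≡ (x ^ j) % p
  powers-apart {x} n ¬p∣x early {i} i<j j≤n e with m≤n⇒∃[o]m+o≡n i<j
  ... | l , refl = early l (≤-trans (s≤s (m≤n+m l i)) j≤n)
                     (power-collision i (suc l) ¬p∣x (subst (λ m → (x ^ i) % p ≡ (x ^ m) % p) (sym (+-suc i l)) e))

  powers-distinct : ∀ {x} n → ¬ p ∣ x → (∀ l → l < n → ¬ (x ^ suc l) % p ≡ 1) →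
                    ∀ i j → i ≤ n → j ≤ n → (x ^ i) % p ≡ (x ^ j) % p → i ≡ j
  powers-distinct n ¬p∣x early i j i≤n j≤n e with <-cmp i j
  ... | tri≈ _ i≡j _ = i≡j
  ... | tri< i<j _ _ = contradiction e (powers-apart n ¬p∣x early i<j j≤n)
  ... | tri> _ _ j<i = contradiction (sym e) (powers-apart n ¬p∣x early j<i i≤n)

  -- A polynomial of degree d with unit leading coefficient has at most d roots
  -- modulo p.  The polynomial with coefficients a₀ ∷ … ∷ a_{d-1} and leading
  -- coefficient ℓ is evaluated by Horner's rule; natural-number coefficients
  -- suffice because division by x - r is expressed without subtraction.
  horner : List ℕ → ℕ → ℕ → ℕ
  horner []       ℓ x = ℓ
  horner (a ∷ as) ℓ x = a + x * horner as ℓ x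

  -- For P = a ∷ as, the quotient Q of P by (x - r): P(x) + r Q(x) = x Q(x) + P(r).
  deflate : List ℕ → ℕ → ℕ → List ℕ
  deflate []       ℓ r = []
  deflate (b ∷ bs) ℓ r = horner (b ∷ bs) ℓ r ∷ deflate bs ℓ r

  length-deflate : ∀ as ℓ r → length (deflate as ℓ r) ≡ length as
  length-deflate []       ℓ r = refl
  length-deflate (b ∷ bs) ℓ r = cong suc (length-deflate bs ℓ r)

  deflate-identity : ∀ a as ℓ r x → horner (a ∷ as) ℓ x + r * horner (deflate as ℓ r) ℓ x
                                     ≡ x * horner (deflate as ℓ r) ℓ x + horner (a ∷ as) ℓ r
  deflate-identity a [] ℓ r x = ring a x ℓ r
    where
    ring : ∀ a x ℓ r → a + x * ℓ + r * ℓ ≡ x * ℓ + (a + r * ℓ)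
    ring = solve-∀
  deflate-identity a (b ∷ bs) ℓ r x = begin
    a + x * P′x + r * (P′r + x * Q′x)  ≡⟨ ring₁ a x P′x r P′r Q′x ⟩
    a + r * P′r + x * (P′x + r * Q′x)  ≡⟨ cong (λ z → a + r * P′r + x * z) (deflate-identity b bs ℓ r x) ⟩
    a + r * P′r + x * (x * Q′x + P′r)  ≡⟨ ring₂ a x r P′r Q′x ⟩
    x * (P′r + x * Q′x) + (a + r * P′r) ∎
    where
    open ≡-Reasoning
    P′x = horner (b ∷ bs) ℓ x
    P′r = horner (b ∷ bs) ℓ r
    Q′x = horner (deflate bs ℓ r) ℓ x
    ring₁ : ∀ a x X r R Y → a + x * X + r * (R + x * Y) ≡ a + r * R + x * (X + r * Y)
    ring₁ = solve-∀
    ring₂ : ∀ a x r R Y → a + r * R + x * (x * Y + R) ≡ x * (R + x * Y) + (a + r * R)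
    ring₂ = solve-∀

  distinct-factors : ∀ {r x Q} → r < p → x < p → ¬ r ≡ x → (r * Q) % p ≡ (x * Q) % p → p ∣ Q
  distinct-factors {r} {x} {Q} r<p x<p r≢x e with p ∣? Q
  ... | yes p∣Q = p∣Q
  ... | no ¬p∣Q = contradiction (%-injective p r<p x<p
                    (*-cancelˡ-% ¬p∣Q (trans (cong (_% p) (*-comm Q r)) (trans e (cong (_% p) (*-comm x Q)))))) r≢x

  root-bound : ∀ d as ℓ → length as ≡ d → ¬ p ∣ ℓ → count (λ x → p ∣? horner as ℓ x) p ≤ d
  root-bound zero    []       ℓ _   ¬p∣ℓ = ≤-reflexive (count-none (λ x → p ∣? ℓ) p (λ _ _ → ¬p∣ℓ))
  root-bound (suc d) (a ∷ as) ℓ len ¬p∣ℓ with least (λ x → p ∣? horner (a ∷ as) ℓ x) p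
  ... | inj₁ none = subst (_≤ suc d) (sym (count-none (λ x → p ∣? horner (a ∷ as) ℓ x) p none)) z≤n
  ... | inj₂ (r , r<p , root , _) = begin
    count Root? p
      ≡⟨ count-split Root? (_≟ r) p ⟩
    count (λ x → Root? x ×-dec ¬? (x ≟ r)) p + count (λ x → Root? x ×-dec (x ≟ r)) p
      ≤⟨ +-mono-≤ (count-mono (λ x → Root? x ×-dec ¬? (x ≟ r)) QRoot? p
                     (λ x x<p (Px , x≢r) → deflate-root x<p Px x≢r))
                  (count-mono (λ x → Root? x ×-dec (x ≟ r)) (_≟ r) p (λ _ _ → proj₂)) ⟩
    count QRoot? p + count (_≟ r) p
      ≡⟨ cong (count QRoot? p +_) (count-unique (_≟ r) p r r<p (λ _ _ e → e) refl) ⟩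
    count QRoot? p + 1
      ≤⟨ +-monoˡ-≤ 1 (root-bound d (deflate as ℓ r) ℓ (trans (length-deflate as ℓ r) (suc-injective len)) ¬p∣ℓ) ⟩
    d + 1
      ≡⟨ +-comm d 1 ⟩
    suc d ∎
    where
    open ≤-Reasoning
    Root?  = λ x → p ∣? horner (a ∷ as) ℓ x
    QRoot? = λ x → p ∣? horner (deflate as ℓ r) ℓ x
    deflate-root : ∀ {x} → x < p → p ∣ horner (a ∷ as) ℓ x → ¬ x ≡ r → p ∣ horner (deflate as ℓ r) ℓ x
    deflate-root {x} x<p Px x≢r = distinct-factors r<p x<p (λ r≡x → x≢r (sym r≡x)) (begin-equality
      (r * Qx) % p        ≡⟨ sym (%-remove-+ˡ (r * Qx) Px) ⟩
      (Px′ + r * Qx) % p  ≡⟨ cong (_% p) (deflate-identity a as ℓ r x) ⟩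
      (x * Qx + Pr) % p   ≡⟨ %-remove-+ʳ (x * Qx) root ⟩
      (x * Qx) % p        ∎)
      where
      Qx  = horner (deflate as ℓ r) ℓ x
      Px′ = horner (a ∷ as) ℓ x
      Pr  = horner (a ∷ as) ℓ r

  horner-monomial : ∀ m x → horner (replicate m 0) 1 x ≡ x ^ m
  horner-monomial zero    x = refl
  horner-monomial (suc m) x = cong (x *_) (horner-monomial m x)

  -- For m ≥ 1, x^m ≡ c has at most m solutions modulo p: they are the roots
  -- of (p - c) + x^m.
  power-roots : ∀ m .{{_ : NonZero m}} c → c < p → count (λ x → (x ^ m) % p ≟ c) p ≤ m
  power-roots (suc m) c c<p = ≤-trans (count-mono (λ x → (x ^ suc m) % p ≟ c) Root? p (λ x _ → root {x}))
                                (root-bound (suc m) ((p ∸ c) ∷ replicate m 0) 1 (cong suc (length-replicate m)) ¬p∣1)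
    where
    Root? = λ x → p ∣? horner ((p ∸ c) ∷ replicate m 0) 1 x
    root : ∀ {x} → (x ^ suc m) % p ≡ c → p ∣ horner ((p ∸ c) ∷ replicate m 0) 1 x
    root {x} e = m%n≡0⇒n∣m _ p (begin
      ((p ∸ c) + x * horner (replicate m 0) 1 x) % p ≡⟨ cong (λ z → ((p ∸ c) + x * z) % p) (horner-monomial m x) ⟩
      ((p ∸ c) + x ^ suc m) % p                      ≡⟨ %-+ p refl (trans e (sym (m<n⇒m%n≡m c<p))) ⟩
      ((p ∸ c) + c) % p                              ≡⟨ cong (_% p) (m∸n+n≡m (<⇒≤ c<p)) ⟩
      p % p                                          ≡⟨ n%n≡0 p ⟩
      0                                              ∎)
      where open ≡-Reasoning

module PowerMap {p : ℕ} (pr : Prime p) where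
  open ModPrime pr

  Fibre : ℕ → ℕ → Pred ℕ 0ℓ
  Fibre m c x = ¬ x ≡ 0 × (x ^ m) % p ≡ c

  fibre? : ∀ m c → Decidable (Fibre m c)
  fibre? m c x = ¬? (x ≟ 0) ×-dec ((x ^ m) % p ≟ c)

  Image : ℕ → Pred ℕ 0ℓ
  Image m c = ¬ c ≡ 0 × PowRes p m c

  image? : ∀ m → Decidable (Image m)
  image? m c = ¬? (c ≟ 0) ×-dec powRes? p m c

  kernelSize imageSize : ℕ → ℕ
  kernelSize m = count (fibre? m 1) p
  imageSize  m = count (image? m) p

  fibre-transport : ∀ m {a c c′} → ¬ p ∣ a → (a ^ m * c) % p ≡ c′ → c′ < p →
                    count (fibre? m c) p ≤ count (fibre? m c′) p
  fibre-transport m {a} {c} {c′} ¬p∣a a^mc≡c′ c′<p =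
    count-injection (fibre? m c) (fibre? m c′) (λ x → (a * x) % p) p p into
      (λ x y x<p y<p _ _ e → %-injective p x<p y<p (*-cancelˡ-% ¬p∣a e))
    where
    into : ∀ x → x < p → Fibre m c x → (a * x) % p < p × Fibre m c′ ((a * x) % p)
    into x x<p (x≢0 , x^m≡c) = m%n<n (a * x) p , unit⇒%≢0 (unit-* ¬p∣a (nonzero⇒unit x<p x≢0)) , (begin
      (((a * x) % p) ^ m) % p  ≡⟨ %-pow p m (m%n%n≡m%n (a * x) p) ⟩
      ((a * x) ^ m) % p        ≡⟨ cong (_% p) (^-distribʳ-* a x m) ⟩
      (a ^ m * x ^ m) % p      ≡⟨ %-*ˡ p (a ^ m) (trans (sym (m%n%n≡m%n (x ^ m) p)) (cong (_% p) x^m≡c)) ⟩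
      (a ^ m * c) % p          ≡⟨ a^mc≡c′ ⟩
      c′                       ∎)
      where open ≡-Reasoning

  -- For m ≥ 1, a fibre over a point outside the image is empty, and a fibre
  -- over a point of the image is a translate of the kernel.
  fibre-outside : ∀ m {c} → ¬ Image (suc m) c → count (fibre? (suc m) c) p ≡ 0
  fibre-outside m {c} ¬image = count-none (fibre? (suc m) c) p (λ x x<p (x≢0 , x^m≡c) → ¬image (c≢0 x<p x≢0 x^m≡c , x , x^m≡c))
    where
    c≢0 : ∀ {x} → x < p → ¬ x ≡ 0 → (x ^ suc m) % p ≡ c → ¬ c ≡ 0
    c≢0 x<p x≢0 x^m≡c c≡0 = unit⇒%≢0 (unit-^ (suc m) (nonzero⇒unit x<p x≢0)) (trans x^m≡c c≡0)

  fibre-inside : ∀ m {c} → c < p → Image (suc m) c → count (fibre? (suc m) c) p ≡ kernelSize (suc m)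
  fibre-inside m {c} c<p (c≢0 , x₀ , x₀^m≡c) = ≤-antisym toKernel fromKernel
    where
    open ≡-Reasoning
    ¬p∣x₀ : ¬ p ∣ x₀
    ¬p∣x₀ p∣x₀ = c≢0 (trans (sym x₀^m≡c) (n∣m⇒m%n≡0 _ p (∣m⇒∣m*n (x₀ ^ m) p∣x₀)))
    u = proj₁ (inverse ¬p∣x₀)
    ux₀≡1 : (u * x₀) % p ≡ 1
    ux₀≡1 = proj₂ (inverse ¬p∣x₀)
    ¬p∣u : ¬ p ∣ u
    ¬p∣u p∣u = 0≢1+n (trans (sym (n∣m⇒m%n≡0 _ p (∣m⇒∣m*n x₀ p∣u))) ux₀≡1)
    toKernel : count (fibre? (suc m) c) p ≤ kernelSize (suc m)
    toKernel = fibre-transport (suc m) ¬p∣u (begin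
      (u ^ suc m * c) % p            ≡⟨ %-*ˡ p (u ^ suc m) (trans (cong (_% p) (sym x₀^m≡c)) (m%n%n≡m%n _ p)) ⟩
      (u ^ suc m * x₀ ^ suc m) % p   ≡⟨ cong (_% p) (sym (^-distribʳ-* u x₀ (suc m))) ⟩
      ((u * x₀) ^ suc m) % p         ≡⟨ %-pow p (suc m) (trans ux₀≡1 (sym 1%p)) ⟩
      (1 ^ suc m) % p                ≡⟨ cong (_% p) (^-zeroˡ (suc m)) ⟩
      1 % p                          ≡⟨ 1%p ⟩
      1                              ∎) 1<p
    fromKernel : kernelSize (suc m) ≤ count (fibre? (suc m) c) p
    fromKernel = fibre-transport (suc m) ¬p∣x₀ (trans (cong (_% p) (*-identityʳ _)) x₀^m≡c) c<p

  fibre-size : ∀ m c → c < p → count (fibre? (suc m) c) p ≡ kernelSize (suc m) * indicator (image? (suc m) c)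
  fibre-size m c c<p = bySide (image? (suc m) c)
    where
    bySide : (image? : Dec (Image (suc m) c)) → count (fibre? (suc m) c) p ≡ kernelSize (suc m) * indicator image?
    bySide (yes image) = trans (fibre-inside m c<p image) (sym (*-identityʳ _))
    bySide (no ¬image) = trans (fibre-outside m ¬image) (sym (*-zeroʳ (kernelSize (suc m))))

  count-units : count (λ x → ¬? (x ≟ 0)) p ≡ p ∸ 1
  count-units = trans (cong (count (λ x → ¬? (x ≟ 0))) p≡1+[p∸1]) (count-nonzero (p ∸ 1))

  -- The fibres partition the p - 1 units, so |image| · |kernel| = p - 1.
  image-kernel : ∀ m → imageSize (suc m) * kernelSize (suc m) ≡ p ∸ 1
  image-kernel m = begin
    imageSize (suc m) * K                                     ≡⟨ *-comm _ K ⟩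
    K * imageSize (suc m)                                     ≡⟨ sym (sumBelow-* p K _) ⟩
    sumBelow (λ c → K * indicator (image? (suc m) c)) p       ≡⟨ sumBelow-cong p (λ c c<p → sym (fibre-size m c c<p)) ⟩
    sumBelow (λ c → count (fibre? (suc m) c) p) p             ≡⟨ count-fibres (λ x → ¬? (x ≟ 0)) (λ x → (x ^ suc m) % p) p p
                                                                               (λ x _ _ → m%n<n _ p) ⟩
    count (λ x → ¬? (x ≟ 0)) p                                ≡⟨ count-units ⟩
    p ∸ 1                                                     ∎
    where
    open ≡-Reasoning
    K = kernelSize (suc m)

  -- Every unit has an order: a least o with x^(o+1) ≡ 1.  Otherwise the p
  -- powers x^0, …, x^(p-1) would be distinct units, but there are only p - 1.
  order : ∀ {x} → ¬ p ∣ x → ∃ λ o → (x ^ suc o) % p ≡ 1 × (∀ l → l < o → ¬ (x ^ suc l) % p ≡ 1)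
  order {x} ¬p∣x with least (λ l → (x ^ suc l) % p ≟ 1) p
  ... | inj₂ (o , _ , x^o≡1 , below) = o , x^o≡1 , below
  ... | inj₁ none = contradiction (begin
    p                               ≡⟨ sym (count-all (λ _ → yes tt) p (λ _ _ → tt)) ⟩
    count (λ _ → yes tt) p          ≤⟨ count-injection (λ _ → yes tt) (λ x → ¬? (x ≟ 0)) (λ i → (x ^ i) % p) p p
                                         (λ i _ _ → m%n<n _ p , unit⇒%≢0 (unit-^ i ¬p∣x))
                                         (λ i j i<p j<p _ _ → powers-distinct p ¬p∣x none i j (<⇒≤ i<p) (<⇒≤ j<p)) ⟩
    count (λ x → ¬? (x ≟ 0)) p      ≡⟨ count-units ⟩
    p ∸ 1                           ∎) (<⇒≱ p∸1<p)
    where open ≤-Reasoning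

  -- If o + 1 is the order of x, the kernel of the
  -- (o+1)-th power map contains the o + 1 distinct powers of x and, by the root
  -- bound, nothing else; so o + 1 divides |image| · |kernel| = p - 1.
  fermat : ∀ {x} → ¬ p ∣ x → (x ^ (p ∸ 1)) % p ≡ 1
  fermat {x} ¬p∣x with order ¬p∣x
  ... | o , x^o≡1 , below = subst (λ e → (x ^ e) % p ≡ 1) p∸1≡I*[1+o] (power-multiple (suc o) I x^o≡1)
    where
    I = imageSize (suc o)
    powers-in-kernel : suc o ≤ kernelSize (suc o)
    powers-in-kernel = subst (_≤ kernelSize (suc o)) (count-all (λ _ → yes tt) (suc o) (λ _ _ → tt))
      (count-injection (λ _ → yes tt) (fibre? (suc o) 1) (λ i → (x ^ i) % p) (suc o) p
        (λ i _ _ → m%n<n _ p , unit⇒%≢0 (unit-^ i ¬p∣x) , in-kernel i)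
        (λ i j i<o j<o _ _ → powers-distinct o ¬p∣x below i j (≤-pred i<o) (≤-pred j<o)))
      where
      in-kernel : ∀ i → (((x ^ i) % p) ^ suc o) % p ≡ 1
      in-kernel i = trans (%-pow p (suc o) (m%n%n≡m%n (x ^ i) p))
                          (trans (cong (_% p) (^-*-assoc x i (suc o))) (power-multiple (suc o) i x^o≡1))
    kernel-roots : kernelSize (suc o) ≤ suc o
    kernel-roots = ≤-trans (count-mono (fibre? (suc o) 1) (λ y → (y ^ suc o) % p ≟ 1) p (λ _ _ → proj₂))
                           (power-roots (suc o) 1 1<p)
    p∸1≡I*[1+o] : I * suc o ≡ p ∸ 1
    p∸1≡I*[1+o] = trans (cong (I *_) (sym (≤-antisym kernel-roots powers-in-kernel))) (image-kernel o)

  -- By Fermat, the kernel of the k-th power map consists of roots of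
  -- y^gcd(k, p-1) ≡ 1, so it has at most gcd(k, p - 1) elements.
  kernel-bound : ∀ k .{{_ : NonZero (gcd k (p ∸ 1))}} → kernelSize k ≤ gcd k (p ∸ 1)
  kernel-bound k = ≤-trans (count-mono (fibre? k 1) (λ y → (y ^ gcd k (p ∸ 1)) % p ≟ 1) p
                             (λ y y<p (y≢0 , y^k≡1) → power-gcd k (p ∸ 1) y^k≡1 (fermat (nonzero⇒unit y<p y≢0))))
                           (power-roots (gcd k (p ∸ 1)) 1 1<p)

  -- If p - 1 divides k e, every non-zero k-th power residue c satisfies
  -- c^e ≡ 1, so there are at most e of them.
  image-bound : ∀ k′ e .{{_ : NonZero e}} → p ∸ 1 ∣ suc k′ * e → imageSize (suc k′) ≤ e
  image-bound k′ e (divides f ke≡f[p∸1]) =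
    ≤-trans (count-mono (image? (suc k′)) (λ c → (c ^ e) % p ≟ 1) p (λ c _ → image-root)) (power-roots e 1 1<p)
    where
    open ≡-Reasoning
    image-root : ∀ {c} → Image (suc k′) c → (c ^ e) % p ≡ 1
    image-root {c} (c≢0 , x , x^k≡c) = begin
      (c ^ e) % p               ≡⟨ %-pow p e (trans (cong (_% p) (sym x^k≡c)) (m%n%n≡m%n _ p)) ⟩
      ((x ^ suc k′) ^ e) % p    ≡⟨ cong (_% p) (trans (^-*-assoc x (suc k′) e) (cong (x ^_) ke≡f[p∸1])) ⟩
      (x ^ (f * (p ∸ 1))) % p   ≡⟨ power-multiple (p ∸ 1) f (fermat ¬p∣x) ⟩
      1                         ∎
      where
      ¬p∣x : ¬ p ∣ x
      ¬p∣x p∣x = c≢0 (trans (sym x^k≡c) (n∣m⇒m%n≡0 _ p (∣m⇒∣m*n (x ^ k′) p∣x)))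

  -- The number of non-zero k-th power residues modulo p is (p - 1)/gcd(k, p - 1):
  -- with d = gcd(k, p - 1) and p - 1 = e d, the bounds |kernel| ≤ d and
  -- |image| ≤ e are attained because |image| · |kernel| = e d.
  power-residue-count : ∀ k .{{_ : NonZero k}} → imageSize k * gcd k (p ∸ 1) ≡ p ∸ 1
  power-residue-count k@(suc k′) = begin
    imageSize k * d  ≡⟨ cong (_* d) (factor-bound (image-bound k′ e p∸1∣ke) (kernel-bound k) (>-nonZero⁻¹ d)
                                                    (trans (image-kernel k′) p∸1≡e*d)) ⟩
    e * d            ≡⟨ sym p∸1≡e*d ⟩
    p ∸ 1            ∎
    where
    open ≡-Reasoning
    d = gcd k (p ∸ 1)
    e = quotient (gcd[m,n]∣n k (p ∸ 1))
    p∸1≡e*d : p ∸ 1 ≡ e * d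
    p∸1≡e*d = _∣_.equality (gcd[m,n]∣n k (p ∸ 1))
    p∸1∣ke : p ∸ 1 ∣ k * e
    p∸1∣ke = subst₂ _∣_ (sym p∸1≡e*d) (*-comm e k) (*-monoʳ-∣ e (gcd[m,n]∣m k (p ∸ 1)))
    instance
      d≢0 : NonZero d
      d≢0 = ≢-nonZero (gcd[m,n]≢0 k (p ∸ 1) (inj₁ (λ ())))
      e≢0 : NonZero e
      e≢0 = ≢-nonZero (λ e≡0 → <⇒≢ 1<p (sym (trans p≡1+[p∸1] (cong suc (trans p∸1≡e*d (cong (_* d) e≡0))))))


module Hensel {p : ℕ} (pr : Prime p) where
  open ModPrime pr

  solve-linear : ∀ {c} → ¬ p ∣ c → ∀ Q₁ Q₂ → ∃ λ t → (Q₁ + c * t) % p ≡ Q₂ % p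
  solve-linear {c} ¬p∣c Q₁ Q₂ = u * X , (begin
    (Q₁ + c * (u * X)) % p   ≡⟨ cong (_% p) (cong (Q₁ +_) (sym (*-assoc c u X))) ⟩
    (Q₁ + c * u * X) % p     ≡⟨ %-+ p refl (%-* p (trans (cong (_% p) (*-comm c u)) (trans uc≡1 (sym 1%p))) refl) ⟩
    (Q₁ + 1 * X) % p         ≡⟨ cong (_% p) (regroup Q₁ Q₂ (p ∸ 1)) ⟩
    (Q₂ + Q₁ * suc (p ∸ 1)) % p ≡⟨ cong (λ q → (Q₂ + Q₁ * q) % p) (sym p≡1+[p∸1]) ⟩
    (Q₂ + Q₁ * p) % p        ≡⟨ [m+kn]%n≡m%n Q₂ Q₁ p ⟩
    Q₂ % p                   ∎)
    where
    open ≡-Reasoning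
    X = Q₂ + (p ∸ 1) * Q₁
    u = proj₁ (inverse ¬p∣c)
    uc≡1 = proj₂ (inverse ¬p∣c)
    regroup : ∀ Q₁ Q₂ q → Q₁ + 1 * (Q₂ + q * Q₁) ≡ Q₂ + Q₁ * suc q
    regroup = solve-∀

  -- One lifting step, from a modulus L divisible by p to p L: with
  -- y^k = R + Q₁ L and a = R + Q₂ L, the root y + t L works when
  -- Q₁ + k y^(k-1) t ≡ Q₂ (mod p), because p L divides (t L)^2.
  hensel-step : ∀ {k′ a y} L .{{_ : NonZero L}} .{{_ : NonZero (p * L)}} → ¬ p ∣ suc k′ → ¬ p ∣ a → p ∣ L →
                (y ^ suc k′) % L ≡ a % L → ∃ λ z → (z ^ suc k′) % (p * L) ≡ a % (p * L)
  hensel-step {k′} {a} {y} L ¬p∣k ¬p∣a p∣L@(divides q L≡qp) y^k≡a = y + t * L , (begin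
    ((y + t * L) ^ suc k′) % (p * L)                            ≡⟨ cong (_% (p * L)) expand ⟩
    (y ^ suc k′ + c * (t * L) + t * L * (t * L) * E) % (p * L)  ≡⟨ cong (λ z → (z + c * (t * L) + t * L * (t * L) * E) % (p * L))
                                                                        y^k≡R+Q₁L ⟩
    (R + Q₁ * L + c * (t * L) + t * L * (t * L) * E) % (p * L)  ≡⟨ cong (_% (p * L)) (regroup L≡qp) ⟩
    (R + (Q₁ + c * t) * L + t * t * q * E * (p * L)) % (p * L)  ≡⟨ [m+kn]%n≡m%n _ (t * t * q * E) (p * L) ⟩
    (R + (Q₁ + c * t) * L) % (p * L)                            ≡⟨ %-+ (p * L) refl (%-scale p L t-solves) ⟩
    (R + Q₂ * L) % (p * L)                                      ≡⟨ cong (_% (p * L)) (sym (m≡m%n+[m/n]*n a L)) ⟩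
    a % (p * L)                                                 ∎)
    where
    open ≡-Reasoning
    R  = a % L
    Q₁ = (y ^ suc k′) / L
    Q₂ = a / L
    c  = suc k′ * y ^ k′
    ¬p∣y : ¬ p ∣ y
    ¬p∣y p∣y = ¬p∣a (m%n≡0⇒n∣m a p (trans (sym (%-divisor p L p∣L y^k≡a)) (n∣m⇒m%n≡0 _ p (∣m⇒∣m*n (y ^ k′) p∣y))))
    t = proj₁ (solve-linear (unit-* ¬p∣k (unit-^ k′ ¬p∣y)) Q₁ Q₂)
    t-solves : (Q₁ + c * t) % p ≡ Q₂ % p
    t-solves = proj₂ (solve-linear (unit-* ¬p∣k (unit-^ k′ ¬p∣y)) Q₁ Q₂)
    E = proj₁ (binomial-linear k′ y (t * L))
    expand : (y + t * L) ^ suc k′ ≡ y ^ suc k′ + c * (t * L) + t * L * (t * L) * E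
    expand = proj₂ (binomial-linear k′ y (t * L))
    y^k≡R+Q₁L : y ^ suc k′ ≡ R + Q₁ * L
    y^k≡R+Q₁L = trans (m≡m%n+[m/n]*n (y ^ suc k′) L) (cong (_+ Q₁ * L) y^k≡a)
    regroup : L ≡ q * p → R + Q₁ * L + c * (t * L) + t * L * (t * L) * E ≡ R + (Q₁ + c * t) * L + t * t * q * E * (p * L)
    regroup refl = ring R Q₁ c t q p E
      where
      ring : ∀ R Q₁ c t q p E → R + Q₁ * (q * p) + c * (t * (q * p)) + t * (q * p) * (t * (q * p)) * E
                                ≡ R + (Q₁ + c * t) * (q * p) + t * t * q * E * (p * (q * p))
      ring = solve-∀

  hensel-lift : ∀ {k′ a y} n → ¬ p ∣ suc k′ → ¬ p ∣ a → (y ^ suc k′) % p ≡ a % p →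
                ∃ λ z → _%_ (z ^ suc k′) (p ^ suc n) {{m^n≢0 p (suc n)}} ≡ _%_ a (p ^ suc n) {{m^n≢0 p (suc n)}}
  hensel-lift {y = y} zero ¬p∣k ¬p∣a y^k≡a =
    y , trans (%-congʳ {{m^n≢0 p 1}} (*-identityʳ p)) (trans y^k≡a (%-congʳ {{_}} {{m^n≢0 p 1}} (sym (*-identityʳ p))))
  hensel-lift {y = y} (suc n) ¬p∣k ¬p∣a y^k≡a with hensel-lift {y = y} n ¬p∣k ¬p∣a y^k≡a
  ... | z , z^k≡a = hensel-step {y = z} (p ^ suc n) {{m^n≢0 p (suc n)}} {{m^n≢0 p (suc (suc n))}} ¬p∣k ¬p∣a (m∣m*n (p ^ n)) z^k≡a

module PrimePowers {p : ℕ} (pr : Prime p) (k′ : ℕ) (¬p∣k : ¬ p ∣ suc k′) where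
  open ModPrime pr
  open PowerMap pr using (Image; image?; imageSize; power-residue-count)
  open Hensel pr using (hensel-lift)

  k : ℕ
  k = suc k′

  PowResₚ : ℕ → Pred ℕ 0ℓ
  PowResₚ n a = PowRes (p ^ n) k a {{m^n≢0 p n}}

  powResₚ? : ∀ n → Decidable (PowResₚ n)
  powResₚ? n = powRes? (p ^ n) k {{m^n≢0 p n}}

  unitResidues multipleResidues : ℕ → ℕ
  unitResidues     n = count (λ a → powResₚ? n a ×-dec ¬? (p ∣? a)) (p ^ n)
  multipleResidues n = count (λ a → powResₚ? n a ×-dec (p ∣? a)) (p ^ n)

  α-split : ∀ n → α k (p ^ n) ≡ unitResidues n + multipleResidues n
  α-split n = trans (α-count k (p ^ n) {{m^n≢0 p n}}) (count-split (powResₚ? n) (p ∣?_) (p ^ n))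

  -- A unit a is a k-th power modulo p^(m+1) iff a mod p is one modulo p
  -- (Hensel); so the unit residues are p^m copies of the image modulo p.
  unitResidues-count : ∀ m → unitResidues (suc m) ≡ p ^ m * imageSize k
  unitResidues-count m = begin
    unitResidues (suc m)                         ≡⟨ count-cong (λ a → powResₚ? (suc m) a ×-dec ¬? (p ∣? a)) (λ a → image? k (a % p))
                                                      N (λ a _ → reduce) lift ⟩
    count (λ a → image? k (a % p)) N             ≡⟨ cong (count (λ a → image? k (a % p))) (*-comm p (p ^ m)) ⟩
    count (λ a → image? k (a % p)) (p ^ m * p)   ≡⟨ count-periodic (image? k) (p ^ m) p ⟩
    p ^ m * imageSize k                          ∎
    where
    open ≡-Reasoning
    N = p ^ suc m
    instance
      N≢0 : NonZero N
      N≢0 = m^n≢0 p (suc m)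
    reduce : ∀ {a} → PowResₚ (suc m) a × ¬ p ∣ a → Image k (a % p)
    reduce {a} ((x , x^k≡a) , ¬p∣a) =
      unit⇒%≢0 ¬p∣a , x , trans (sym (m∣n⇒o%n%m≡o%m p N (x ^ k) (m∣m*n (p ^ m)))) (cong (_% p) x^k≡a)
    lift : ∀ a → a < N → Image k (a % p) → PowResₚ (suc m) a × ¬ p ∣ a
    lift a a<N (a≢0 , x , x^k≡a) = (z , trans z^k≡a (m<n⇒m%n≡m a<N)) , ¬p∣a
      where
      ¬p∣a : ¬ p ∣ a
      ¬p∣a p∣a = a≢0 (n∣m⇒m%n≡0 a p p∣a)
      lifted = hensel-lift {y = x} m ¬p∣k ¬p∣a x^k≡a
      z = proj₁ lifted
      z^k≡a = proj₂ lifted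

  root-divisible : ∀ N .{{_ : NonZero N}} x → p ∣ N → p ∣ (x ^ k) % N → p ∣ x
  root-divisible N x p∣N p∣r = ∣^⇒∣ k (∣n∣m%n⇒∣m p∣N p∣r)

  multipleResidues-small : ∀ m → suc m ≤ k → multipleResidues (suc m) ≡ 1
  multipleResidues-small m m<k =
    count-unique (λ a → powResₚ? (suc m) a ×-dec (p ∣? a)) N 0 (m^n>0 p (suc m)) only ((0 , m<n⇒m%n≡m (m^n>0 p (suc m))) , p ∣0)
    where
    N = p ^ suc m
    instance
      N≢0 : NonZero N
      N≢0 = m^n≢0 p (suc m)
    only : ∀ a → a < N → PowResₚ (suc m) a × p ∣ a → a ≡ 0
    only a _ ((x , x^k≡a) , p∣a) = trans (sym x^k≡a) (n∣m⇒m%n≡0 _ N (∣-trans (^-monoʳ-∣ p m<k)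
      (^-pres-∣ k (root-divisible N x (m∣m*n (p ^ m)) (subst (p ∣_) (sym x^k≡a) p∣a)))))

  -- From the exponent k on, the k-th power residues modulo p^(k+n+1) divisible
  -- by p are the p^k b with b a k-th power residue modulo p^(n+1).
  module _ (n : ℕ) where
    private
      K M N : ℕ
      K = p ^ k
      M = p ^ suc n
      N = p ^ (k + suc n)
      instance
        K≢0 : NonZero K
        K≢0 = m^n≢0 p k
        M≢0 : NonZero M
        M≢0 = m^n≢0 p (suc n)
        N≢0 : NonZero N
        N≢0 = m^n≢0 p (k + suc n)
      N≡K*M : N ≡ K * M
      N≡K*M = ^-distribˡ-+-* p k (suc n)
      K∣N : K ∣ N
      K∣N = divides M (trans N≡K*M (*-comm K M))
      p∣N : p ∣ N
      p∣N = ∣-trans (m∣m*n (p ^ k′)) K∣N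
      power-of-multiple : ∀ z → ((p * z) ^ k) % N ≡ K * ((z ^ k) % M)
      power-of-multiple z = begin
        ((p * z) ^ k) % N          ≡⟨ cong (_% N) (^-distribʳ-* p z k) ⟩
        (K * z ^ k) % N            ≡⟨ %-congʳ {{_}} {{m*n≢0 K M}} N≡K*M ⟩
        _%_ (K * z ^ k) (K * M) {{m*n≢0 K M}} ≡⟨ %-*-common K M (z ^ k) ⟩
        K * ((z ^ k) % M)          ∎
        where open ≡-Reasoning

    divisible-residue : ∀ a → PowResₚ (k + suc n) a × p ∣ a → K ∣ a × PowResₚ (k + suc n) a
    divisible-residue a (r@(x , x^k≡a) , p∣a) =
      subst (K ∣_) x^k≡a (%-presˡ-∣ (^-pres-∣ k (root-divisible N x p∣N (subst (p ∣_) (sym x^k≡a) p∣a))) K∣N) , r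

    scaled-residue⇒ : ∀ b → PowResₚ (k + suc n) (K * b) → PowResₚ (suc n) b
    scaled-residue⇒ b (x , x^k≡Kb) with root-divisible N x p∣N (subst (p ∣_) (sym x^k≡Kb) (∣m⇒∣m*n b (m∣m*n (p ^ k′))))
    ... | divides z refl = z , *-cancelˡ-≡ _ b K (begin
      K * ((z ^ k) % M)  ≡⟨ sym (power-of-multiple z) ⟩
      ((p * z) ^ k) % N  ≡⟨ cong (λ y → (y ^ k) % N) (*-comm p z) ⟩
      ((z * p) ^ k) % N  ≡⟨ x^k≡Kb ⟩
      K * b              ∎)
      where open ≡-Reasoning

    scaled-residue⇐ : ∀ b → PowResₚ (suc n) b → PowResₚ (k + suc n) (K * b)
    scaled-residue⇐ b (z , z^k≡b) = p * z , trans (power-of-multiple z) (cong (K *_) z^k≡b)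

    multipleResidues-large : multipleResidues (k + suc n) ≡ α k M
    multipleResidues-large = begin
      multipleResidues (k + suc n)
        ≡⟨ count-cong (λ a → powResₚ? (k + suc n) a ×-dec (p ∣? a)) Scaled? N (λ a _ → divisible-residue a)
                      (λ a _ (K∣a , r) → r , ∣-trans (m∣m*n (p ^ k′)) K∣a) ⟩
      count Scaled? N
        ≡⟨ cong (count Scaled?) N≡K*M ⟩
      count Scaled? (K * M)
        ≡⟨ count-multiples (powResₚ? (k + suc n)) K M ⟩
      count (λ b → powResₚ? (k + suc n) (K * b)) M
        ≡⟨ count-cong (λ b → powResₚ? (k + suc n) (K * b)) (powResₚ? (suc n)) M
                      (λ b _ → scaled-residue⇒ b) (λ b _ → scaled-residue⇐ b) ⟩
      count (powResₚ? (suc n)) M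
        ≡⟨ sym (α-count k M) ⟩
      α k M ∎
      where
      open ≡-Reasoning
      Scaled? = λ a → (K ∣? a) ×-dec powResₚ? (k + suc n) a

  A : ℕ → ℕ
  A n = α k (p ^ n)

  U : ℕ
  U = imageSize k

  α-small : ∀ m → suc m ≤ k → A (suc m) ≡ p ^ m * U + 1
  α-small m m<k = trans (α-split (suc m)) (cong₂ _+_ (unitResidues-count m) (multipleResidues-small m m<k))

  α-shift : ∀ n → A (k + suc n) ≡ p ^ (k + n) * U + A (suc n)
  α-shift n = trans (α-split (k + suc n)) (cong₂ _+_ unit-part (multipleResidues-large n))
    where
    unit-part : unitResidues (k + suc n) ≡ p ^ (k + n) * U
    unit-part = trans (cong unitResidues (+-suc k n)) (unitResidues-count (k + n))

  α-closed : ∀ q r → suc r ≤ k → A (suc r + q * k) ≡ 1 + U * p ^ r * geometric (p ^ k) q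
  α-closed zero r r<k = begin
    A (suc r + 0)       ≡⟨ cong A (+-identityʳ (suc r)) ⟩
    A (suc r)           ≡⟨ α-small r r<k ⟩
    p ^ r * U + 1       ≡⟨ trans (+-comm _ 1) (cong (1 +_) (trans (*-comm (p ^ r) U) (sym (*-identityʳ _)))) ⟩
    1 + U * p ^ r * 1   ∎
    where open ≡-Reasoning
  α-closed (suc q) r r<k = begin
    A (suc r + (k + q * k))                        ≡⟨ cong A (reorder (suc r) k (q * k)) ⟩
    A (k + suc (r + q * k))                        ≡⟨ α-shift (r + q * k) ⟩
    p ^ (k + (r + q * k)) * U + A (suc r + q * k)  ≡⟨ cong₂ (λ e a → p ^ e * U + a) (reorder k r (q * k)) (α-closed q r r<k) ⟩
    p ^ (r + (k + q * k)) * U + (1 + U * W * G)    ≡⟨ cong (λ z → z * U + (1 + U * W * G)) (^-distribˡ-+-* p r (k + q * k)) ⟩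
    W * p ^ (k + q * k) * U + (1 + U * W * G)      ≡⟨ cong (λ z → W * z * U + (1 + U * W * G)) (^-*-assoc′ (suc q)) ⟩
    W * P ^ suc q * U + (1 + U * W * G)            ≡⟨ regroup W (P ^ suc q) U G ⟩
    1 + U * W * (G + P ^ suc q)                    ∎
    where
    open ≡-Reasoning
    P = p ^ k
    W = p ^ r
    G = geometric P q
    reorder : ∀ a b c → a + (b + c) ≡ b + (a + c)
    reorder a b c = trans (sym (+-assoc a b c)) (trans (cong (_+ c) (+-comm a b)) (+-assoc b a c))
    ^-*-assoc′ : ∀ q → p ^ (q * k) ≡ P ^ q
    ^-*-assoc′ q = trans (cong (p ^_) (*-comm q k)) (sym (^-*-assoc p k q))
    regroup : ∀ W Y U G → W * Y * U + (1 + U * W * G) ≡ 1 + U * W * (G + Y)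
    regroup = solve-∀

  d : ℕ
  d = gcd k (p ∸ 1)

  U*d≡p∸1 : U * d ≡ p ∸ 1
  U*d≡p∸1 = power-residue-count k

  1+U+[d∸1]U≡p : 1 + U + (d ∸ 1) * U ≡ p
  1+U+[d∸1]U≡p = begin
    suc (suc (d ∸ 1) * U)  ≡⟨ cong (λ e → suc (e * U)) (suc-pred d {{≢-nonZero (gcd[m,n]≢0 k (p ∸ 1) (inj₁ (λ ())))}}) ⟩
    suc (d * U)            ≡⟨ cong suc (trans (*-comm d U) U*d≡p∸1) ⟩
    suc (p ∸ 1)            ≡⟨ sym p≡1+[p∸1] ⟩
    p                      ∎
    where open ≡-Reasoning

  α-at-period : ∀ q → A (suc (q * k)) + (d ∸ 1) * U ≡ p * A (q * k)
  α-at-period zero = begin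
    A 1 + (d ∸ 1) * U          ≡⟨ cong (_+ (d ∸ 1) * U) (α-small 0 (s≤s z≤n)) ⟩
    1 * U + 1 + (d ∸ 1) * U    ≡⟨ base U (d ∸ 1) p 1+U+[d∸1]U≡p ⟩
    p * A 0                    ∎
    where
    open ≡-Reasoning
    base : ∀ U D p → 1 + U + D * U ≡ p → 1 * U + 1 + D * U ≡ p * 1
    base U D .(1 + U + D * U) refl = ring U D
      where
      ring : ∀ U D → 1 * U + 1 + D * U ≡ (1 + U + D * U) * 1
      ring = solve-∀
  α-at-period (suc q) = begin
    A (suc (k + q * k)) + (d ∸ 1) * U                   ≡⟨ cong (_+ (d ∸ 1) * U) (α-closed (suc q) 0 (s≤s z≤n)) ⟩
    1 + U * 1 * geometric (p ^ k) (suc q) + (d ∸ 1) * U ≡⟨ cong (λ g → 1 + U * 1 * g + (d ∸ 1) * U) (geometric-horner (p ^ k) q) ⟩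
    1 + U * 1 * (1 + p * W * G) + (d ∸ 1) * U            ≡⟨ step U (d ∸ 1) W G p 1+U+[d∸1]U≡p ⟩
    p * (1 + U * W * G)                                  ≡⟨ cong (p *_) (sym (α-closed q k′ ≤-refl)) ⟩
    p * A (k + q * k)                                    ∎
    where
    open ≡-Reasoning
    W = p ^ k′
    G = geometric (p ^ k) q
    step : ∀ U D W G p → 1 + U + D * U ≡ p → 1 + U * 1 * (1 + p * W * G) + D * U ≡ p * (1 + U * W * G)
    step U D W G .(1 + U + D * U) refl = ring U D W G
      where
      ring : ∀ U D W G → 1 + U * 1 * (1 + (1 + U + D * U) * W * G) + D * U ≡ (1 + U + D * U) * (1 + U * W * G)
      ring = solve-∀

  recurrence-at-period : ∀ m → k ∣ m → d * A (suc m) + (d ∸ 1) * (p ∸ 1) ≡ d * (p * A m)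
  recurrence-at-period m (divides q refl) = begin
    d * A (suc (q * k)) + (d ∸ 1) * (p ∸ 1)   ≡⟨ cong (λ z → d * A (suc (q * k)) + (d ∸ 1) * z) (sym U*d≡p∸1) ⟩
    d * A (suc (q * k)) + (d ∸ 1) * (U * d)   ≡⟨ factor d (A (suc (q * k))) (d ∸ 1) U ⟩
    d * (A (suc (q * k)) + (d ∸ 1) * U)       ≡⟨ cong (d *_) (α-at-period q) ⟩
    d * (p * A (q * k))                       ∎
    where
    open ≡-Reasoning
    factor : ∀ d A D U → d * A + D * (U * d) ≡ d * (A + D * U)
    factor = solve-∀

  α-off-period : ∀ q r → suc r < k → A (suc (suc r + q * k)) + p ≡ p * A (suc r + q * k) + 1
  α-off-period q r r<k = begin
    A (suc (suc r) + q * k) + p              ≡⟨ cong (_+ p) (α-closed q (suc r) r<k) ⟩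
    1 + U * (p * p ^ r) * G + p              ≡⟨ ring U p (p ^ r) G ⟩
    p * (1 + U * p ^ r * G) + 1              ≡⟨ cong (λ a → p * a + 1) (sym (α-closed q r (<⇒≤ r<k))) ⟩
    p * A (suc r + q * k) + 1                ∎
    where
    open ≡-Reasoning
    G = geometric (p ^ k) q
    ring : ∀ U p W G → 1 + U * (p * W) * G + p ≡ p * (1 + U * W * G) + 1
    ring = solve-∀

  recurrence-off-period : ∀ m → ¬ k ∣ m → A (suc m) + p ≡ p * A m + 1
  recurrence-off-period m k∤m with m % k | m≡m%n+[m/n]*n m k | m%n<n m k
  ... | zero  | m≡qk     | _   = contradiction (divides (m / k) m≡qk) k∤m
  ... | suc r | m≡r+1+qk | r<k = subst (λ m → A (suc m) + p ≡ p * A m + 1) (sym m≡r+1+qk) (α-off-period (m / k) r r<k)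

  -- The closed form of the theorem, cleared of denominators.
  closed-form : ∀ q r → suc r ≤ k →
    (A (suc r + q * k) ∸ 1) * (d * (p ^ k ∸ 1)) ≡ (p ∸ 1) * (p ^ (suc r + q * k + k ∸ 1) ∸ p ^ (suc r ∸ 1))
  closed-form q r r<k = begin
    (A (suc r + q * k) ∸ 1) * (d * X)          ≡⟨ cong (λ a → (a ∸ 1) * (d * X)) (α-closed q r r<k) ⟩
    (U * W * G) * (d * X)                      ≡⟨ regroup U W G d X ⟩
    (U * d) * (W * (G * X))                    ≡⟨ cong₂ _*_ U*d≡p∸1 (sym (m+n∸n≡m (W * (G * X)) W)) ⟩
    (p ∸ 1) * (W * (G * X) + W ∸ W)            ≡⟨ cong (λ z → (p ∸ 1) * (z ∸ W)) (sym distribute) ⟩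
    (p ∸ 1) * (W * (G * X + 1) ∸ W)            ≡⟨ cong (λ z → (p ∸ 1) * (W * z ∸ W)) (geometric-sum q P≡1+X) ⟩
    (p ∸ 1) * (W * P ^ suc q ∸ W)              ≡⟨ cong (λ z → (p ∸ 1) * (W * z ∸ W)) (^-*-assoc p k (suc q)) ⟩
    (p ∸ 1) * (W * p ^ (k * suc q) ∸ W)        ≡⟨ cong (λ z → (p ∸ 1) * (z ∸ W)) (sym (^-distribˡ-+-* p r (k * suc q))) ⟩
    (p ∸ 1) * (p ^ (r + k * suc q) ∸ W)        ≡⟨ cong (λ e → (p ∸ 1) * (p ^ e ∸ W)) (exponent r q) ⟩
    (p ∸ 1) * (p ^ (r + q * k + k) ∸ W)        ∎
    where
    open ≡-Reasoning
    P = p ^ k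
    X = P ∸ 1
    W = p ^ r
    G = geometric P q
    P≡1+X : P ≡ suc X
    P≡1+X = sym (trans (+-comm 1 X) (m∸n+n≡m (m^n>0 p k)))
    regroup : ∀ U W G d X → (U * W * G) * (d * X) ≡ (U * d) * (W * (G * X))
    regroup = solve-∀
    distribute : W * (G * X + 1) ≡ W * (G * X) + W
    distribute = trans (*-distribˡ-+ W (G * X) 1) (cong (W * (G * X) +_) (*-identityʳ W))
    exponent : ∀ r q → r + k * suc q ≡ r + q * k + k
    exponent r q = trans (cong (r +_) (trans (*-comm k (suc q)) (+-comm k (q * k)))) (sym (+-assoc r (q * k) k))

proposition2p14 : (k p : ℕ) → 1 ≤ k → Prime p → ¬ (p ∣ k) →
    ((n : ℕ) → 1 ≤ n →
      (k ∣ (n ∸ 1) →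
        gcd k (p ∸ 1) * α k (p ^ n) + (gcd k (p ∸ 1) ∸ 1) * (p ∸ 1)
          ≡ gcd k (p ∸ 1) * (p * α k (p ^ (n ∸ 1))))
      × (¬ (k ∣ (n ∸ 1)) →
        α k (p ^ n) + p ≡ p * α k (p ^ (n ∸ 1)) + 1))
    × ((n r : ℕ) → 1 ≤ n → 1 ≤ r → r ≤ k → ∃ (λ q → n ≡ r + q * k) →
        (α k (p ^ n) ∸ 1) * (gcd k (p ∸ 1) * (p ^ k ∸ 1))
          ≡ (p ∸ 1) * (p ^ (n + k ∸ 1) ∸ p ^ (r ∸ 1)))
proposition2p14 (suc k′) p _ pr ¬p∣k =
    (λ { (suc m) _ → recurrence-at-period m , recurrence-off-period m })
  , (λ { _ (suc r) _ _ r<k (q , refl) → closed-form q r r<k })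
  where open PrimePowers pr k′ ¬p∣k
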